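{- A finite simple graph $G$ belongs to $\mathcal{C}_3$ if and only if $\chi_c(G)<2$.
   Context: A circular ordering of a finite set $X$ is a ternary relation $C\subseteq X^3$ such that for all $x,y,z,w\in X$: $(x,y,z)\in C\Rightarrow(y,z,x)\in C$; $(x,y,z)\in C\Rightarrow(x,z,y)\notin C$; $(x,y,z),(x,z,w)\in C\Rightarrow(x,y,w)\in C$; and for distinct $x,y,z$ either $(x,y,z)\in C$ or $(x,z,y)\in C$. For a graph $G$ with circular ordering $C$ of $V(G)$, write $SP_3\to(G,C)$ if there exist vertices $u_1,u_2,u_3$ with $u_1u_2,u_2u_3\in E(G)$, $u_1\ne u_2$, and either $u_3=u_1$ or ($u_3\notin\{u_1,u_2\}$ and $(u_2,u_3,u_1)\in C$). $\mathcal{C}_3$ is the class of graphs $G$ admitting a circular ordering $C$ of $V(G)$ with $SP_3\not\to(G,C)$. For positive integers $q\le p$, $K_{p/q}$ is the graph on $\{0,\dots,p-1\}$ with $ij\in E$ iff $\min(|i-j|,p-|i-j|)\ge q$; $\chi_c(G)=\inf\{p/q: q\le p\le|V(G)|,\ G\to K_{p/q}\}$ ($\to$ = graph homomorphism exists). -}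

module Defs where

open import Data.Nat using (ℕ; zero; suc; _+_; _*_; _∸_; _≤_; _<_; ∣_-_∣; _⊓_)
open import Data.Fin using (Fin; toℕ)
open import Data.Product using (Σ; ∃; ∃-syntax; _×_; _,_)
open import Data.Sum using (_⊎_)
open import Relation.Nullary using (¬_)
open import Relation.Binary.PropositionalEquality using (_≡_; _≢_)

record SimpleGraph (n : ℕ) : Set₁ where
  field
    Adj    : Fin n → Fin n → Set
    sym    : ∀ {u v} → Adj u v → Adj v u
    irrefl : ∀ {u} → ¬ Adj u u
open SimpleGraph public

record IsCircularOrdering {n : ℕ} (C : Fin n → Fin n → Fin n → Set) : Set where
  field
    cyclic     : ∀ {x y z} → C x y z → C y z x
    asymmetric : ∀ {x y z} → C x y z → ¬ C x z y
    transitive : ∀ {x y z w} → C x y z → C x z w → C x y w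
    total      : ∀ {x y z} → x ≢ y → y ≢ z → x ≢ z → C x y z ⊎ C x z y

SP3→ : ∀ {n} → SimpleGraph n → (Fin n → Fin n → Fin n → Set) → Set
SP3→ {n} G C = ∃[ u₁ ] ∃[ u₂ ] ∃[ u₃ ]
  (Adj G u₁ u₂ × Adj G u₂ u₃ × u₁ ≢ u₂ ×
   (u₃ ≡ u₁ ⊎ (u₃ ≢ u₁ × u₃ ≢ u₂ × C u₂ u₃ u₁)))

In𝒞₃ : ∀ {n} → SimpleGraph n → Set₁
In𝒞₃ {n} G = Σ (Fin n → Fin n → Fin n → Set) λ C →
  IsCircularOrdering C × ¬ SP3→ G C

KAdj : (p q : ℕ) → Fin p → Fin p → Set
KAdj p q i j = q ≤ (∣ toℕ i - toℕ j ∣ ⊓ (p ∸ ∣ toℕ i - toℕ j ∣))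

_⟶K[_/_] : ∀ {n} → SimpleGraph n → (p q : ℕ) → Set
_⟶K[_/_] {n} G p q = Σ (Fin n → Fin p) λ f →
  ∀ {u v} → Adj G u v → KAdj p q (f u) (f v)

-- χ_c(G) < 2 : the infimum of the finite set
--   { p/q : 1 ≤ q ≤ p ≤ |V(G)|, G → K_{p/q} }
-- is < 2, i.e. some element p/q of this finite set satisfies p/q < 2 (⇔ p < 2q).
χc<2 : ∀ {n} → SimpleGraph n → Set
χc<2 {n} G = ∃[ p ] ∃[ q ]
  (1 ≤ q × q ≤ p × p ≤ n × (G ⟶K[ p / q ]) × p < 2 * q)

-- Both conditions say that G has no edges. An edge uv yields the closed walk
-- u v u, an SP₃ in every circular ordering, while without edges there is no
-- SP₃ at all. An edge of K_{p/q} joins points whose two arcs on a cycle of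
-- length p both have length at least q, forcing 2q ≤ p; so χ_c(G) < 2 means G
-- maps to an edgeless K_{p/q}, and an edgeless G maps to K_{1/1}.
module Submission where

open import Defs
open import Data.Empty using (⊥; ⊥-elim)
open import Data.Fin using (Fin; toℕ; zero)
open import Data.Fin.Properties using (toℕ<n; <-strictTotalOrder)
open import Data.Nat using (ℕ; _+_; _*_; _∸_; _≤_; _<_; _⊓_; _⊔_; ∣_-_∣; z≤n; s≤s)
open import Data.Nat.Properties
  using (≤-refl; ≤-trans; <⇒≤; <⇒≱; +-identityʳ; +-mono-≤; m⊓n≤m; m⊓n≤n; ⊔-lub; ∣m-n∣≤m⊔n; m+[n∸m]≡n; module ≤-Reasoning)
open import Data.Product using (_×_; _,_)
open import Data.Sum using (_⊎_; inj₁; inj₂)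
open import Function.Bundles using (_⇔_; mk⇔)
open import Level using (Level)
open import Relation.Binary.Bundles using (StrictTotalOrder)
open import Relation.Binary.Definitions using (tri<; tri≈; tri>)
open import Relation.Binary.PropositionalEquality using (_≡_; refl; cong)
open import Relation.Nullary using (¬_)

module CyclicOrder {a ℓ₁ ℓ₂ : Level} (O : StrictTotalOrder a ℓ₁ ℓ₂) where
  open StrictTotalOrder O renaming (Carrier to A; _<_ to _≺_)

  Cyclic : A → A → A → Set ℓ₂
  Cyclic x y z = (x ≺ y × y ≺ z) ⊎ (y ≺ z × z ≺ x) ⊎ (z ≺ x × x ≺ y)

  cyclic : ∀ {x y z} → Cyclic x y z → Cyclic y z x
  cyclic (inj₁ xyz)        = inj₂ (inj₂ xyz)
  cyclic (inj₂ (inj₁ yzx)) = inj₁ yzx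
  cyclic (inj₂ (inj₂ zxy)) = inj₂ (inj₁ zxy)

  cyclic-asym : ∀ {x y z} → Cyclic x y z → ¬ Cyclic x z y
  cyclic-asym (inj₁ (_ , y<z))        (inj₁ (_ , z<y))        = asym y<z z<y
  cyclic-asym (inj₁ (x<y , _))        (inj₂ (inj₁ (_ , y<x))) = asym x<y y<x
  cyclic-asym (inj₁ (x<y , _))        (inj₂ (inj₂ (y<x , _))) = asym x<y y<x
  cyclic-asym (inj₂ (inj₁ (_ , z<x))) (inj₁ (x<z , _))        = asym z<x x<z
  cyclic-asym (inj₂ (inj₁ (y<z , _))) (inj₂ (inj₁ (z<y , _))) = asym y<z z<y
  cyclic-asym (inj₂ (inj₁ (_ , z<x))) (inj₂ (inj₂ (_ , x<z))) = asym z<x x<z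
  cyclic-asym (inj₂ (inj₂ (z<x , _))) (inj₁ (x<z , _))        = asym z<x x<z
  cyclic-asym (inj₂ (inj₂ (_ , x<y))) (inj₂ (inj₁ (_ , y<x))) = asym x<y y<x
  cyclic-asym (inj₂ (inj₂ (_ , x<y))) (inj₂ (inj₂ (y<x , _))) = asym x<y y<x

  cyclic-trans : ∀ {x y z w} → Cyclic x y z → Cyclic x z w → Cyclic x y w
  cyclic-trans (inj₁ (x<y , y<z))        (inj₁ (_ , z<w))        = inj₁ (x<y , trans y<z z<w)
  cyclic-trans (inj₁ (x<y , y<z))        (inj₂ (inj₁ (z<w , w<x))) = ⊥-elim (asym (trans x<y y<z) (trans z<w w<x))
  cyclic-trans (inj₁ (x<y , _))          (inj₂ (inj₂ (w<x , _))) = inj₂ (inj₂ (w<x , x<y))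
  cyclic-trans (inj₂ (inj₁ (_ , z<x)))   (inj₁ (x<z , _))        = ⊥-elim (asym z<x x<z)
  cyclic-trans (inj₂ (inj₁ (y<z , _)))   (inj₂ (inj₁ (z<w , w<x))) = inj₂ (inj₁ (trans y<z z<w , w<x))
  cyclic-trans (inj₂ (inj₁ (_ , z<x)))   (inj₂ (inj₂ (_ , x<z))) = ⊥-elim (asym z<x x<z)
  cyclic-trans (inj₂ (inj₂ (z<x , _)))   (inj₁ (x<z , _))        = ⊥-elim (asym z<x x<z)
  cyclic-trans (inj₂ (inj₂ (_ , x<y)))   (inj₂ (inj₁ (_ , w<x))) = inj₂ (inj₂ (w<x , x<y))
  cyclic-trans (inj₂ (inj₂ (z<x , _)))   (inj₂ (inj₂ (_ , x<z))) = ⊥-elim (asym z<x x<z)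

  cyclic-total : ∀ {x y z} → ¬ x ≈ y → ¬ y ≈ z → ¬ x ≈ z → Cyclic x y z ⊎ Cyclic x z y
  cyclic-total {x} {y} {z} x≉y y≉z x≉z with compare x y | compare y z | compare x z
  ... | tri≈ _ x≈y _ | _            | _            = ⊥-elim (x≉y x≈y)
  ... | _            | tri≈ _ y≈z _ | _            = ⊥-elim (y≉z y≈z)
  ... | _            | _            | tri≈ _ x≈z _ = ⊥-elim (x≉z x≈z)
  ... | tri< x<y _ _ | tri< y<z _ _ | _            = inj₁ (inj₁ (x<y , y<z))
  ... | tri< _ _ _   | tri> _ _ z<y | tri< x<z _ _ = inj₂ (inj₁ (x<z , z<y))
  ... | tri< x<y _ _ | tri> _ _ _   | tri> _ _ z<x = inj₁ (inj₂ (inj₂ (z<x , x<y)))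
  ... | tri> _ _ y<x | tri< _ _ _   | tri< x<z _ _ = inj₂ (inj₂ (inj₂ (y<x , x<z)))
  ... | tri> _ _ _   | tri< y<z _ _ | tri> _ _ z<x = inj₁ (inj₂ (inj₁ (y<z , z<x)))
  ... | tri> _ _ y<x | tri> _ _ z<y | _            = inj₂ (inj₂ (inj₁ (z<y , y<x)))

finCyclicOrdering : (n : ℕ) → IsCircularOrdering (CyclicOrder.Cyclic (<-strictTotalOrder n))
finCyclicOrdering n = record
  { cyclic     = cyclic
  ; asymmetric = cyclic-asym
  ; transitive = cyclic-trans
  ; total      = cyclic-total
  }
  where open CyclicOrder (<-strictTotalOrder n)

Edgeless : ∀ {n} → SimpleGraph n → Set
Edgeless {n} G = ∀ {u v : Fin n} → ¬ Adj G u v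

edge⇒SP3→ : ∀ {n} (G : SimpleGraph n) C {u v} → Adj G u v → SP3→ G C
edge⇒SP3→ G C {u} {v} uv = u , v , u , uv , SimpleGraph.sym G uv , u≢v , inj₁ refl
  where
    u≢v : u ≡ v → ⊥
    u≢v refl = irrefl G uv

In𝒞₃⇒edgeless : ∀ {n} (G : SimpleGraph n) → In𝒞₃ G → Edgeless G
In𝒞₃⇒edgeless G (C , _ , ¬sp) uv = ¬sp (edge⇒SP3→ G C uv)

edgeless⇒In𝒞₃ : ∀ {n} (G : SimpleGraph n) → Edgeless G → In𝒞₃ G
edgeless⇒In𝒞₃ {n} G noEdge = _ , finCyclicOrdering n , λ (_ , _ , _ , uv , _) → noEdge uv

∣i-j∣≤p : ∀ {p} (i j : Fin p) → ∣ toℕ i - toℕ j ∣ ≤ p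
∣i-j∣≤p {p} i j = begin
  ∣ toℕ i - toℕ j ∣ ≤⟨ ∣m-n∣≤m⊔n (toℕ i) (toℕ j) ⟩
  toℕ i ⊔ toℕ j     ≤⟨ ⊔-lub (<⇒≤ (toℕ<n i)) (<⇒≤ (toℕ<n j)) ⟩
  p                 ∎
  where open ≤-Reasoning

-- d and p ∸ d are the two arcs between points at distance d on a cycle of length p.
both-arcs≥q⇒2q≤p : ∀ {p q d} → d ≤ p → q ≤ d ⊓ (p ∸ d) → 2 * q ≤ p
both-arcs≥q⇒2q≤p {p} {q} {d} d≤p q≤arcs = begin
  2 * q         ≡⟨ cong (q +_) (+-identityʳ q) ⟩
  q + q         ≤⟨ +-mono-≤ (≤-trans q≤arcs (m⊓n≤m d _)) (≤-trans q≤arcs (m⊓n≤n d _)) ⟩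
  d + (p ∸ d)   ≡⟨ m+[n∸m]≡n d≤p ⟩
  p             ∎
  where open ≤-Reasoning

KAdj⇒2q≤p : ∀ {p q} (i j : Fin p) → KAdj p q i j → 2 * q ≤ p
KAdj⇒2q≤p i j = both-arcs≥q⇒2q≤p (∣i-j∣≤p i j)

χc<2⇒edgeless : ∀ {n} (G : SimpleGraph n) → χc<2 G → Edgeless G
χc<2⇒edgeless G (_ , _ , _ , _ , _ , (f , hom) , p<2q) {u} {v} uv =
  <⇒≱ p<2q (KAdj⇒2q≤p (f u) (f v) (hom uv))

edgeless⇒χc<2 : ∀ {n} (G : SimpleGraph n) → 0 < n → Edgeless G → χc<2 G
edgeless⇒χc<2 G 0<n noEdge =
  1 , 1 , ≤-refl , ≤-refl , 0<n , ((λ _ → zero) , λ uv → ⊥-elim (noEdge uv)) , s≤s (s≤s z≤n)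

mainTheorem18 : (n : ℕ) → 0 < n → (G : SimpleGraph n) → In𝒞₃ G ⇔ χc<2 G
mainTheorem18 n 0<n G = mk⇔
  (λ G∈𝒞₃ → edgeless⇒χc<2 G 0<n (In𝒞₃⇒edgeless G G∈𝒞₃))
  (λ χ<2 → edgeless⇒In𝒞₃ G (χc<2⇒edgeless G χ<2))
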